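{- A comparability graph $G$ is uniquely quasi-transitively orientable if and only if $G$ admits only trivial quasi-transitive $2$-edge-colourings.
   Context: A comparability graph is a graph admitting a transitive orientation (equivalently, the comparability graph of a partial order). A quasi-transitive orientation of a graph $G$ is an orientation of its edges such that whenever $u\to v$ and $v\to w$ are arcs with $u\neq w$, the vertices $u$ and $w$ are adjacent in $G$ (i.e., there is no induced directed path of length $2$). $G$ is uniquely quasi-transitively orientable if it has exactly two quasi-transitive orientations. A quasi-transitive $2$-edge-colouring of $G$ is a map $c: E(G)\to\{R,B\}$ such that for all pairs of edges $xy, yz \in E(G)$ with $c(xy)\neq c(yz)$, we have $xz\in E(G)$; it is trivial if it is constant on $E(G)$. -}

module Defs where

open import Data.Nat using (ℕ)
open import Data.Fin using (Fin)
open import Data.Bool using (Bool; true; false)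
open import Data.Product using (_×_; Σ; ∃; ∃-syntax; _,_)
open import Data.Sum using (_⊎_)
open import Relation.Nullary using (¬_)
open import Relation.Binary.PropositionalEquality using (_≡_; _≢_)

record Graph : Set where
  field
    n      : ℕ
    adj    : Fin n → Fin n → Bool
    sym    : ∀ u v → adj u v ≡ adj v u
    irrefl : ∀ u → adj u u ≡ false

module _ (G : Graph) where
  open Graph G

  Edge : Fin n → Fin n → Set
  Edge u v = adj u v ≡ true

  record IsOrientation (o : Fin n → Fin n → Bool) : Set where
    field
      arc⇒edge  : ∀ u v → o u v ≡ true → Edge u v
      edge⇒arc  : ∀ u v → Edge u v → (o u v ≡ true) ⊎ (o v u ≡ true)
      antisym   : ∀ u v → o u v ≡ true → o v u ≡ false

  IsTransitiveOrientation : (Fin n → Fin n → Bool) → Set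
  IsTransitiveOrientation o =
    IsOrientation o ×
    (∀ u v w → o u v ≡ true → o v w ≡ true → o u w ≡ true)

  IsQTOrientation : (Fin n → Fin n → Bool) → Set
  IsQTOrientation o =
    IsOrientation o ×
    (∀ u v w → o u v ≡ true → o v w ≡ true → u ≢ w → Edge u w)

  _≈O_ : (Fin n → Fin n → Bool) → (Fin n → Fin n → Bool) → Set
  o ≈O o' = ∀ u v → o u v ≡ o' u v

  IsComparabilityGraph : Set
  IsComparabilityGraph = ∃[ o ] IsTransitiveOrientation o

  UniquelyQTOrientable : Set
  UniquelyQTOrientable =
    Σ (Fin n → Fin n → Bool) λ o₁ → Σ (Fin n → Fin n → Bool) λ o₂ →
      IsQTOrientation o₁ × IsQTOrientation o₂ × ¬ (o₁ ≈O o₂) ×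
      (∀ o → IsQTOrientation o → (o ≈O o₁) ⊎ (o ≈O o₂))

  data Colour : Set where
    R B : Colour

  -- a 2-edge-colouring: a colour for each edge, i.e. a map on ordered
  -- pairs that is symmetric along edges (values on non-edges are ignored)
  IsEdgeColouring : (Fin n → Fin n → Colour) → Set
  IsEdgeColouring c = ∀ u v → Edge u v → c u v ≡ c v u

  IsQTColouring : (Fin n → Fin n → Colour) → Set
  IsQTColouring c =
    IsEdgeColouring c ×
    (∀ x y z → Edge x y → Edge y z → c x y ≢ c y z → Edge x z)

  IsTrivialColouring : (Fin n → Fin n → Colour) → Set
  IsTrivialColouring c =
    ∀ u v x y → Edge u v → Edge x y → c u v ≡ c x y

  OnlyTrivialQTColourings : Set
  OnlyTrivialQTColourings =
    ∀ c → IsQTColouring c → IsTrivialColouring c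

  HasEdge : Set
  HasEdge = ∃[ u ] ∃[ v ] Edge u v

-- Fix a transitive orientation T. For any two quasi-transitive orientations,
-- colouring each edge by whether they agree on it is a quasi-transitive
-- colouring: along an induced path x–y–z both orientations must point both
-- arcs into y or both out of y, so the colour cannot change there.
-- Conversely, reversing T on the blue edges of a quasi-transitive colouring
-- yields a quasi-transitive orientation whose agreement colouring with T is
-- the given one. Under this correspondence T and its reverse are exactly the
-- trivial colourings.
module Submission where

open import Defs
open import Function.Bundles using (_⇔_; mk⇔)
open import Data.Fin using (Fin; _≟_)
open import Data.Bool using (Bool; true; false; not)
open import Data.Bool.Properties using (not-¬)
open import Data.Product using (_,_; proj₁)
open import Data.Sum using (_⊎_; inj₁; inj₂)
open import Data.Empty using (⊥-elim)
open import Relation.Nullary using (¬_; yes; no)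
open import Relation.Binary.PropositionalEquality

module _ (G : Graph) where
  open Graph G using (n; adj)
  open IsOrientation

  Orientation : Set
  Orientation = Fin n → Fin n → Bool

  Colouring : Set
  Colouring = Fin n → Fin n → Colour G

  private variable
    o o' p q T : Orientation
    c : Colouring
    u v w : Fin n

  edge-sym : Edge G u v → Edge G v u
  edge-sym {u} {v} e = trans (Graph.sym G v u) e

  nonEdge : adj u v ≡ false → ¬ Edge G u v
  nonEdge ¬uv uv = not-¬ uv ¬uv

  nonEdge⇒nonArc : IsOrientation G o → adj u v ≡ false → o u v ≡ false
  nonEdge⇒nonArc {o} {u} {v} io ¬uv with o u v in a
  ... | false = refl
  ... | true  = ⊥-elim (nonEdge ¬uv (arc⇒edge io u v a))

  arc-flip : IsOrientation G o → Edge G u v → o v u ≡ not (o u v)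
  arc-flip {o} {u} {v} io uv with o u v in a
  ... | true = antisym io u v a
  ... | false with edge⇒arc io u v uv
  ...   | inj₁ a′ = ⊥-elim (not-¬ a′ a)
  ...   | inj₂ a′ = a′

  isOrientation-from-flip : (∀ u v → o u v ≡ true → Edge G u v) →
                            (∀ u v → Edge G u v → o v u ≡ not (o u v)) →
                            IsOrientation G o
  isOrientation-from-flip {o} arcs flip = record
    { arc⇒edge = arcs
    ; edge⇒arc = oneDirection
    ; antisym  = λ u v a → trans (flip u v (arcs u v a)) (cong not a)
    }
    where
    oneDirection : ∀ u v → Edge G u v → o u v ≡ true ⊎ o v u ≡ true
    oneDirection u v uv with o u v in a
    ... | true  = inj₁ refl
    ... | false = inj₂ (trans (flip u v uv) (cong not a))

  reverse : Orientation → Orientation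
  reverse o u v = o v u

  reverse-isOrientation : IsOrientation G o → IsOrientation G (reverse o)
  reverse-isOrientation io = isOrientation-from-flip
    (λ u v a → edge-sym (arc⇒edge io v u a))
    (λ u v uv → arc-flip io (edge-sym uv))

  reverse-isQT : IsQTOrientation G o → IsQTOrientation G (reverse o)
  reverse-isQT (io , qt) =
    reverse-isOrientation io ,
    λ u v w a b u≢w → edge-sym (qt w v u b a (≢-sym u≢w))

  transitive⇒QT : IsTransitiveOrientation G o → IsQTOrientation G o
  transitive⇒QT (io , tr) = io , λ u v w a b _ → arc⇒edge io u w (tr u v w a b)

  ≈O-sym : _≈O_ G o o' → _≈O_ G o' o
  ≈O-sym o≈o' u v = sym (o≈o' u v)

  ≈O-trans : _≈O_ G o o' → _≈O_ G o' p → _≈O_ G o p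
  ≈O-trans o≈o' o'≈p u v = trans (o≈o' u v) (o'≈p u v)

  ≉reverse : HasEdge G → IsOrientation G o → ¬ _≈O_ G o (reverse o)
  ≉reverse (u , v , uv) io o≈ = not-¬ (sym (o≈ u v)) (arc-flip io uv)

  agreeOnEdges⇒≈O : IsOrientation G o → IsOrientation G o' →
                    (∀ u v → Edge G u v → o u v ≡ o' u v) → _≈O_ G o o'
  agreeOnEdges⇒≈O io io' agree u v with adj u v in uv
  ... | true  = agree u v uv
  ... | false = trans (nonEdge⇒nonArc io uv) (sym (nonEdge⇒nonArc io' uv))

  QT-inducedPath : IsQTOrientation G o → Edge G u v → Edge G v w →
                   adj u w ≡ false → o v w ≡ not (o u v)
  QT-inducedPath {o} {u} {v} {w} (io , qt) uv vw ¬uw with u ≟ w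
  ... | yes refl = arc-flip io uv
  ... | no u≢w with o u v in a | o v w in b
  ...   | true  | false = refl
  ...   | false | true  = refl
  ...   | true  | true  = ⊥-elim (nonEdge ¬uw (qt u v w a b u≢w))
  ...   | false | false =
    ⊥-elim (nonEdge ¬uw (edge-sym (qt w v u (backwards vw b) (backwards uv a) (≢-sym u≢w))))
    where
    backwards : ∀ {x y} → Edge G x y → o x y ≡ false → o y x ≡ true
    backwards xy f = trans (arc-flip io xy) (cong not f)

  twoQTOrientations-exhaust : UniquelyQTOrientable G →
                              IsQTOrientation G p → IsQTOrientation G q → ¬ _≈O_ G p q →
                              ∀ o → IsQTOrientation G o → _≈O_ G o p ⊎ _≈O_ G o q
  twoQTOrientations-exhaust {p} {q} (_ , _ , _ , _ , _ , only) qp qq p≉q o qo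
    with only p qp | only q qq | only o qo
  ... | inj₁ p≈ | inj₁ q≈ | _       = ⊥-elim (p≉q (≈O-trans p≈ (≈O-sym q≈)))
  ... | inj₂ p≈ | inj₂ q≈ | _       = ⊥-elim (p≉q (≈O-trans p≈ (≈O-sym q≈)))
  ... | inj₁ p≈ | inj₂ _  | inj₁ o≈ = inj₁ (≈O-trans o≈ (≈O-sym p≈))
  ... | inj₁ _  | inj₂ q≈ | inj₂ o≈ = inj₂ (≈O-trans o≈ (≈O-sym q≈))
  ... | inj₂ _  | inj₁ q≈ | inj₁ o≈ = inj₂ (≈O-trans o≈ (≈O-sym q≈))
  ... | inj₂ p≈ | inj₁ _  | inj₂ o≈ = inj₁ (≈O-trans o≈ (≈O-sym p≈))

  agreement : Bool → Bool → Colour G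
  agreement true  true  = R
  agreement false false = R
  agreement true  false = B
  agreement false true  = B

  agreement-self : ∀ a → agreement a a ≡ R
  agreement-self true  = refl
  agreement-self false = refl

  agreement-not-self : ∀ a → agreement (not a) a ≡ B
  agreement-not-self true  = refl
  agreement-not-self false = refl

  agreement-not : ∀ a b → agreement (not a) (not b) ≡ agreement a b
  agreement-not true  true  = refl
  agreement-not true  false = refl
  agreement-not false true  = refl
  agreement-not false false = refl

  agreement≡R⇒≡ : ∀ {a b} → agreement a b ≡ R → a ≡ b
  agreement≡R⇒≡ {true}  {true}  _ = refl
  agreement≡R⇒≡ {false} {false} _ = refl

  agreement≡B⇒≡not : ∀ {a b} → agreement a b ≡ B → a ≡ not b
  agreement≡B⇒≡not {true}  {false} _ = refl
  agreement≡B⇒≡not {false} {true}  _ = refl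

  agreementColouring : Orientation → Orientation → Colouring
  agreementColouring o o' u v = agreement (o u v) (o' u v)

  agreementColouring-isEdgeColouring : IsOrientation G o → IsOrientation G o' →
                                       IsEdgeColouring G (agreementColouring o o')
  agreementColouring-isEdgeColouring io io' u v uv =
    sym (trans (cong₂ agreement (arc-flip io uv) (arc-flip io' uv)) (agreement-not _ _))

  agreementColouring-isQT : IsQTOrientation G o → IsQTOrientation G o' →
                            IsQTColouring G (agreementColouring o o')
  agreementColouring-isQT {o} {o'} qo qo' =
    agreementColouring-isEdgeColouring (proj₁ qo) (proj₁ qo') , closes
    where
    closes : ∀ x y z → Edge G x y → Edge G y z →
             agreementColouring o o' x y ≢ agreementColouring o o' y z → Edge G x z
    closes x y z xy yz colourChanges with adj x z in xz
    ... | true  = refl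
    ... | false = ⊥-elim (colourChanges (sym (trans
                    (cong₂ agreement (QT-inducedPath qo xy yz xz) (QT-inducedPath qo' xy yz xz))
                    (agreement-not _ _))))

  trivialAgreement⇒≈O⊎≈Oreverse : HasEdge G → IsOrientation G o → IsOrientation G o' →
                                   IsTrivialColouring G (agreementColouring o o') →
                                   _≈O_ G o o' ⊎ _≈O_ G o (reverse o')
  trivialAgreement⇒≈O⊎≈Oreverse {o} {o'} (u₀ , v₀ , e₀) io io' trivial
    with agreementColouring o o' u₀ v₀ in c₀
  ... | R = inj₁ (agreeOnEdges⇒≈O io io' λ u v uv →
              agreement≡R⇒≡ (trans (trivial u v u₀ v₀ uv e₀) c₀))
  ... | B = inj₂ (agreeOnEdges⇒≈O io (reverse-isOrientation io') λ u v uv →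
              trans (agreement≡B⇒≡not (trans (trivial u v u₀ v₀ uv e₀) c₀))
                    (sym (arc-flip io' uv)))

  ≈O⊎≈Oreverse⇒trivialAgreement : IsOrientation G o' →
                                   _≈O_ G o o' ⊎ _≈O_ G o (reverse o') →
                                   IsTrivialColouring G (agreementColouring o o')
  ≈O⊎≈Oreverse⇒trivialAgreement {o'} {o} _ (inj₁ o≈) u v x y _ _ =
    trans (allRed u v) (sym (allRed x y))
    where
    allRed : ∀ u v → agreementColouring o o' u v ≡ R
    allRed u v = trans (cong (λ a → agreement a (o' u v)) (o≈ u v)) (agreement-self _)
  ≈O⊎≈Oreverse⇒trivialAgreement {o'} {o} io' (inj₂ o≈) u v x y uv xy =
    trans (allBlue uv) (sym (allBlue xy))
    where
    allBlue : ∀ {u v} → Edge G u v → agreementColouring o o' u v ≡ B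
    allBlue {u} {v} uv =
      trans (cong (λ a → agreement a (o' u v)) (trans (o≈ u v) (arc-flip io' uv)))
            (agreement-not-self _)

  select : Colour G → Bool → Bool → Bool
  select R a _ = a
  select B _ b = b

  reverseBlue : Colouring → Orientation → Orientation
  reverseBlue c T u v = select (c u v) (T u v) (T v u)

  reverseBlue-isOrientation : IsEdgeColouring G c → IsOrientation G T →
                              IsOrientation G (reverseBlue c T)
  reverseBlue-isOrientation {c} {T} csym io = isOrientation-from-flip arcs flip
    where
    arcs : ∀ u v → reverseBlue c T u v ≡ true → Edge G u v
    arcs u v a with c u v
    ... | R = arc⇒edge io u v a
    ... | B = edge-sym (arc⇒edge io v u a)
    flip : ∀ u v → Edge G u v → reverseBlue c T v u ≡ not (reverseBlue c T u v)
    flip u v uv rewrite csym v u (edge-sym uv) with c u v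
    ... | R = arc-flip io uv
    ... | B = arc-flip io (edge-sym uv)

  reverseBlue-isQT : IsTransitiveOrientation G T → IsQTColouring G c →
                     IsQTOrientation G (reverseBlue c T)
  reverseBlue-isQT {T} {c} (io , tr) (csym , closes) =
    reverseBlue-isOrientation csym io , qt
    where
    qt : ∀ u v w → reverseBlue c T u v ≡ true → reverseBlue c T v w ≡ true →
         u ≢ w → Edge G u w
    qt u v w a b _ with c u v in cuv | c v w in cvw
    ... | R | R = arc⇒edge io u w (tr u v w a b)
    ... | B | B = edge-sym (arc⇒edge io w u (tr w v u b a))
    ... | R | B = closes u v w (arc⇒edge io u v a) (edge-sym (arc⇒edge io w v b))
                    (subst₂ _≢_ (sym cuv) (sym cvw) λ ())
    ... | B | R = closes u v w (edge-sym (arc⇒edge io v u a)) (arc⇒edge io v w b)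
                    (subst₂ _≢_ (sym cuv) (sym cvw) λ ())

  agreementColouring-reverseBlue : IsOrientation G T → Edge G u v →
                                   agreementColouring (reverseBlue c T) T u v ≡ c u v
  agreementColouring-reverseBlue {T} {u} {v} {c} io uv with c u v
  ... | R = agreement-self (T u v)
  ... | B = trans (cong (λ a → agreement a (T u v)) (arc-flip io uv)) (agreement-not-self (T u v))

  onlyTrivial⇒uniquelyQT : IsTransitiveOrientation G T → HasEdge G →
                           OnlyTrivialQTColourings G → UniquelyQTOrientable G
  onlyTrivial⇒uniquelyQT {T} tT edge trivial =
    T , reverse T , qT , reverse-isQT qT , ≉reverse edge (proj₁ tT) , classify
    where
    qT : IsQTOrientation G T
    qT = transitive⇒QT tT
    classify : ∀ o → IsQTOrientation G o → _≈O_ G o T ⊎ _≈O_ G o (reverse T)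
    classify o qo = trivialAgreement⇒≈O⊎≈Oreverse edge (proj₁ qo) (proj₁ tT)
                      (trivial _ (agreementColouring-isQT qo qT))

  uniquelyQT⇒onlyTrivial : IsTransitiveOrientation G T → HasEdge G →
                           UniquelyQTOrientable G → OnlyTrivialQTColourings G
  uniquelyQT⇒onlyTrivial {T} tT edge unique c qc u v x y uv xy =
    begin
      c u v                            ≡⟨ sym (agreementColouring-reverseBlue {c = c} (proj₁ tT) uv) ⟩
      agreementColouring flipped T u v ≡⟨ trivialAgreement u v x y uv xy ⟩
      agreementColouring flipped T x y ≡⟨ agreementColouring-reverseBlue {c = c} (proj₁ tT) xy ⟩
      c x y                            ∎
    where
    open ≡-Reasoning
    flipped : Orientation
    flipped = reverseBlue c T
    qT : IsQTOrientation G T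
    qT = transitive⇒QT tT
    trivialAgreement : IsTrivialColouring G (agreementColouring flipped T)
    trivialAgreement = ≈O⊎≈Oreverse⇒trivialAgreement (proj₁ tT)
      (twoQTOrientations-exhaust unique qT (reverse-isQT qT) (≉reverse edge (proj₁ tT))
                                 flipped (reverseBlue-isQT tT qc))

theorem34 : (G : Graph) → IsComparabilityGraph G → HasEdge G →
    (UniquelyQTOrientable G ⇔ OnlyTrivialQTColourings G)
theorem34 G (T , tT) edge =
  mk⇔ (uniquelyQT⇒onlyTrivial G tT edge) (onlyTrivial⇒uniquelyQT G tT edge)
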